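{- In the setting described in the context, suppose $C_1\neq C_2$ are elements of $S_0$ such that the multidegree $C_1-C_2\in\mathbb{Z}^{S_0}$ has image zero in $\Phi=J_k/J_k^0$. Then there is a unique path in the graph $G$ from $C_1$ to $C_2$ all of whose edges are disconnecting double points.
   Context: Let $D$ be a complete discrete valuation ring with uniformizer $\pi$, fraction field $K$, separably closed residue field $k$; $X_K$ a smooth proper geometrically irreducible curve over $K$, and $X$ a proper flat nodal model over $D$ (geometric special fibre has only ordinary double points). At each singular point $x$ of $X_k$, $\widehat{\mathcal{O}}_{X,x}\cong D[[u,v]]/(uv-\pi^{e(x)})$. $S_0$ is the set of irreducible components of the normalization of $X_k$, $S_1$ the set of singular points of $X_k$, and $G$ the graph with vertices $S_0$ and edges $S_1$ (an edge $x$ joins the components containing the points above $x$). A double point $x$ is disconnecting if $X_k-\{x\}$ is disconnected. $J={\rm Pic}^{[0]}_{X/D}/\mathcal{E}$ (closure of ${\rm Pic}^0_{X_K/K}$ in ${\rm Pic}_{X/D}$ modulo the closure of the identity section), $\Phi=J_k/J_k^0$. Let $F\subset\mathbb{Z}^{S_0}$ be the group of $a$ with $a(C)\equiv a(C')\pmod{e(x)}$ whenever $x$ joins $C$ and $C'$, and $\delta\colon F\to\mathbb{Z}^{S_0}$ the multidegree map $\delta(a)(C)=\sum_{x'}(a(C'_{x'})-a(C))/e(x)$, sum over the points $x'$ of $C$ above singular points $x$, $C'_{x'}$ the component through the other point above $x$. Then $\Phi$ is canonically isomorphic to $\{b\in\mathbb{Z}^{S_0}:\sum_Cb(C)=0\}/\delta(F)$;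 this is how an element of $\mathbb{Z}^{S_0}$ of total degree $0$ (a multidegree) has an image in $\Phi$. -}

module Defs where

open import Data.Nat using (ℕ; zero; suc)
open import Data.Fin using (Fin; zero; suc; _≟_)
open import Data.Integer using (ℤ; +_; _-_; _*_; _+_; 0ℤ; 1ℤ)
open import Data.List using (List; []; _∷_)
open import Data.List.Relation.Unary.All using (All)
open import Data.List.Relation.Unary.Unique.Propositional using (Unique)
open import Data.Product using (Σ; _×_; ∃; ∃-syntax)
open import Data.Bool using (if_then_else_)
open import Relation.Binary.PropositionalEquality using (_≡_; _≢_)
open import Relation.Nullary using (¬_)
open import Relation.Nullary.Decidable using (isYes)

-- The dual graph G of the special fibre, with the thicknesses e(x).
-- Vertices S₀ = Fin nV (components of the normalization of X_k),
-- edges S₁ = Fin nE (double points). Edge x joins src x and tgt x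
-- (the components through the two points above x; src x = tgt x for a
-- node whose two branches lie on the same component).
-- thick x = e(x), where Ô_{X,x} ≅ D[[u,v]]/(uv - π^{e(x)}).
record Graph : Set where
  field
    nV nE : ℕ
    src tgt : Fin nE → Fin nV
    thick : Fin nE → ℕ

sumℤ : (m : ℕ) → (Fin m → ℤ) → ℤ
sumℤ zero    f = 0ℤ
sumℤ (suc m) f = f zero + sumℤ m (λ i → f (suc i))

module _ (G : Graph) where
  open Graph G

  data Step : Fin nV → Fin nV → Set where
    fwd : (x : Fin nE) → Step (src x) (tgt x)
    bwd : (x : Fin nE) → Step (tgt x) (src x)

  data Walk : Fin nV → Fin nV → Set where
    []  : ∀ {u} → Walk u u
    _∷_ : ∀ {u v w} → Step u v → Walk v w → Walk u w

  stepEdge : ∀ {u v} → Step u v → Fin nE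
  stepEdge (fwd x) = x
  stepEdge (bwd x) = x

  edges : ∀ {u v} → Walk u v → List (Fin nE)
  edges []       = []
  edges (s ∷ w) = stepEdge s ∷ edges w

  vertices : ∀ {u v} → Walk u v → List (Fin nV)
  vertices {u} []      = u ∷ []
  vertices {u} (s ∷ w) = u ∷ vertices w

  IsPath : ∀ {u v} → Walk u v → Set
  IsPath w = Unique (vertices w)

  Connected : Set
  Connected = ∀ u v → Walk u v

  ConnectedWithout : Fin nE → Set
  ConnectedWithout x = ∀ u v → Σ (Walk u v) (λ w → All (_≢ x) (edges w))

  -- x is a disconnecting double point: X_k - {x} is disconnected
  Disconnecting : Fin nE → Set
  Disconnecting x = ¬ ConnectedWithout x

  -- a ∈ F, with the witnesses q(x) = (a(tgt x) - a(src x)) / e(x)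
  -- (the quotient is unique since e(x) ≥ 1)
  InF : (Fin nV → ℤ) → (Fin nE → ℤ) → Set
  InF a q = ∀ x → a (tgt x) - a (src x) ≡ q x * + thick x

  ind : Fin nV → Fin nV → ℤ
  ind i C = if isYes (i ≟ C) then 1ℤ else 0ℤ

  -- δ(a)(C) = Σ_{x'} (a(C'_{x'}) - a(C)) / e(x): edge x contributes
  -- q x at its src end and -q x at its tgt end.
  δ : (Fin nE → ℤ) → Fin nV → ℤ
  δ q C = sumℤ nE (λ x → (if isYes (src x ≟ C) then q x else 0ℤ)
                        - (if isYes (tgt x ≟ C) then q x else 0ℤ))

  -- the multidegree C₁ - C₂ has image zero in Φ = Z^{S₀}_{deg 0} / δ(F)
  ImageZeroInΦ : Fin nV → Fin nV → Set
  ImageZeroInΦ C₁ C₂ =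
    ∃[ a ] ∃[ q ] (InF a q × (∀ C → δ q C ≡ ind C₁ C - ind C₂ C))

{-# OPTIONS --safe #-}
-- The hypothesis provides a ∈ F and q with a(tgt x) − a(src x) = q(x)·e(x) and
-- δ q = [C₁] − [C₂]: q is a unit flow from C₁ to C₂ which, as e ≥ 1, runs strictly
-- uphill for the potential a.  Pairing δ q with the indicator of a sublevel set
-- {a ≤ t} shows that the flow across that cut is [a C₁ ≤ t] − [a C₂ ≤ t] ≤ 1, while
-- each edge crossing the level t carries at least 1.  So every level is crossed by at
-- most one edge, and an edge whose ends have different potentials is disconnecting:
-- a walk around it would cross its level a second time.  Following the flow back
-- from C₂ gives a walk from C₁ on which a strictly increases, i.e. a path of
-- disconnecting edges.  Uniqueness is pure graph theory: if two such paths left a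
-- vertex along different edges, together they would give a detour around the first.
module Submission where

open import Defs
import Data.Integer.Properties as ℤ
open import Algebra.Properties.AbelianGroup ℤ.+-0-abelianGroup using (⁻¹-anti-homo‿-)
open import Algebra.Properties.Ring ℤ.+-*-ring using (x[y-z]≈xy-xz; [y-z]x≈yx-zx)
open import Algebra.Properties.Semiring.Sum ℤ.+-*-semiring
  using (sum; sum-syntax; sum-cong-≗; sum-remove; sum-replicate-zero; ∑-comm; ∑-distrib-+; *-distribˡ-sum)
open import Data.Bool using (Bool; true; false; if_then_else_)
open import Data.Fin using (Fin; zero; suc; _≟_; punchIn; punchOut)
open import Data.Fin.Induction using (spo-wellFounded)
open import Data.Fin.Properties using (punchInᵢ≢i; punchIn-punchOut; ¬∀⟶∃¬)
open import Data.Integer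
  using (ℤ; +_; _+_; _-_; _*_; -_; 0ℤ; 1ℤ; -1ℤ; _≤_; _<_; _≤?_; +≤+; +<+; -≤+; -<+)
open import Data.Integer.Base using (positive)
open import Data.List.Membership.Propositional using (_∈_)
open import Data.List.Relation.Unary.All as All using (All; []; _∷_)
open import Data.List.Relation.Unary.AllPairs using ([]; _∷_)
open import Data.List.Relation.Unary.Any using (here; there)
open import Data.Nat as ℕ using (zero; suc; s≤s; z≤n)
open import Data.Product using (Σ; Σ-syntax; ∃-syntax; _×_; _,_; proj₁; proj₂; map₂)
open import Data.Sum using (_⊎_; inj₁; inj₂)
open import Data.Vec.Functional using (removeAt)
open import Function using (_∘_; _on_)
open import Induction.WellFounded using (Acc; acc)
import Relation.Binary.Construct.On as On
open import Relation.Binary.PropositionalEquality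
  using (_≡_; _≢_; refl; sym; trans; cong; cong₂; subst; module ≡-Reasoning)
open import Relation.Nullary using (¬_; Dec; yes; no; contradiction)
open import Relation.Nullary.Decidable using (isYes; decidable-stable)

sumℤ≡sum : ∀ n (f : Fin n → ℤ) → sumℤ n f ≡ sum f
sumℤ≡sum zero    f = refl
sumℤ≡sum (suc n) f = cong (_+_ (f zero)) (sumℤ≡sum n (f ∘ suc))

∑-neg : ∀ {n} (f : Fin n → ℤ) → ∑[ i < n ] (- f i) ≡ - ∑[ i < n ] f i
∑-neg {zero}  f = refl
∑-neg {suc n} f =
  trans (cong (_+_ (- f zero)) (∑-neg (f ∘ suc))) (sym (ℤ.neg-distrib-+ (f zero) _))

∑-distrib-- : ∀ {n} (f g : Fin n → ℤ) →
              ∑[ i < n ] (f i - g i) ≡ ∑[ i < n ] f i - ∑[ i < n ] g i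
∑-distrib-- f g = trans (∑-distrib-+ f (-_ ∘ g)) (cong (_+_ (sum f)) (∑-neg g))

∑-nonneg : ∀ {n} (f : Fin n → ℤ) → (∀ i → 0ℤ ≤ f i) → 0ℤ ≤ ∑[ i < n ] f i
∑-nonneg {zero}  f f≥0 = ℤ.≤-refl
∑-nonneg {suc n} f f≥0 = ℤ.+-mono-≤ (f≥0 zero) (∑-nonneg (f ∘ suc) (f≥0 ∘ suc))

∑-≥-term : ∀ {n} (f : Fin n → ℤ) → (∀ i → 0ℤ ≤ f i) → ∀ i → f i ≤ ∑[ i < n ] f i
∑-≥-term {suc n} f f≥0 i = begin
  f i                       ≡⟨ ℤ.+-identityʳ (f i) ⟨
  f i + 0ℤ                  ≤⟨ ℤ.+-monoʳ-≤ (f i) (∑-nonneg (removeAt f i) (f≥0 ∘ punchIn i)) ⟩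
  f i + sum (removeAt f i)  ≡⟨ sum-remove f ⟨
  sum f                     ∎
  where open ℤ.≤-Reasoning

∑-≥-two-terms : ∀ {n} (f : Fin n → ℤ) → (∀ i → 0ℤ ≤ f i) →
                ∀ {i j} → i ≢ j → f i + f j ≤ ∑[ i < n ] f i
∑-≥-two-terms {suc n} f f≥0 {i} {j} i≢j = begin
  f i + f j                          ≡⟨ cong (λ k → f i + f k) (punchIn-punchOut i≢j) ⟨
  f i + removeAt f i (punchOut i≢j)  ≤⟨ ℤ.+-monoʳ-≤ (f i) (∑-≥-term (removeAt f i) (f≥0 ∘ punchIn i) _) ⟩
  f i + sum (removeAt f i)           ≡⟨ sum-remove f ⟨
  sum f                              ∎
  where open ℤ.≤-Reasoning

negative-term : ∀ {n} (f : Fin n → ℤ) → ¬ (∀ i → 0ℤ ≤ f i) → ∃[ i ] f i < 0ℤ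
negative-term {n} f ¬f≥0 = map₂ ℤ.≰⇒> (¬∀⟶∃¬ n (λ i → 0ℤ ≤ f i) (λ i → 0ℤ ≤? f i) ¬f≥0)

module _ {p} {P : Set p} {A : Set} {y z : A} where

  if-yes : (P? : Dec P) → P → (if isYes P? then y else z) ≡ y
  if-yes (yes _) _ = refl
  if-yes (no ¬P) P = contradiction P ¬P

  if-no : (P? : Dec P) → ¬ P → (if isYes P? then y else z) ≡ z
  if-no (yes P) ¬P = contradiction P ¬P
  if-no (no _)  _  = refl

single : ∀ {n} → Fin n → ℤ → Fin n → ℤ
single c y C = if isYes (c ≟ C) then y else 0ℤ

∑-*-single : ∀ {n} (w : Fin n → ℤ) c y → ∑[ C < n ] (w C * single c y C) ≡ w c * y
∑-*-single {suc n} w c y = begin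
  ∑[ C < suc n ] (w C * single c y C)
    ≡⟨ sum-remove {i = c} (λ C → w C * single c y C) ⟩
  w c * single c y c + ∑[ j < n ] (w (punchIn c j) * single c y (punchIn c j))
    ≡⟨ cong₂ _+_ (cong (w c *_) (if-yes (c ≟ c) refl)) (sum-cong-≗ vanishes-off-c) ⟩
  w c * y + ∑[ j < n ] 0ℤ
    ≡⟨ cong (_+_ (w c * y)) (sum-replicate-zero n) ⟩
  w c * y + 0ℤ
    ≡⟨ ℤ.+-identityʳ (w c * y) ⟩
  w c * y
    ∎
  where
  open ≡-Reasoning
  vanishes-off-c : ∀ j → w (punchIn c j) * single c y (punchIn c j) ≡ 0ℤ
  vanishes-off-c j = trans (cong (w (punchIn c j) *_) (if-no (c ≟ punchIn c j) (punchInᵢ≢i c j ∘ sym)))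
                           (ℤ.*-zeroʳ (w (punchIn c j)))

∑-*-single-difference : ∀ {n} (w : Fin n → ℤ) c c′ y →
                        ∑[ C < n ] (w C * (single c y C - single c′ y C)) ≡ (w c - w c′) * y
∑-*-single-difference {n} w c c′ y = begin
  ∑[ C < n ] (w C * (single c y C - single c′ y C))
    ≡⟨ sum-cong-≗ (λ C → x[y-z]≈xy-xz (w C) _ _) ⟩
  ∑[ C < n ] (w C * single c y C - w C * single c′ y C)
    ≡⟨ ∑-distrib-- (λ C → w C * single c y C) (λ C → w C * single c′ y C) ⟩
  ∑[ C < n ] (w C * single c y C) - ∑[ C < n ] (w C * single c′ y C)
    ≡⟨ cong₂ _-_ (∑-*-single w c y) (∑-*-single w c′ y) ⟩
  w c * y - w c′ * y
    ≡⟨ [y-z]x≈yx-zx y (w c) (w c′) ⟨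
  (w c - w c′) * y
    ∎
  where open ≡-Reasoning

χ : Bool → ℤ
χ b = if b then 1ℤ else 0ℤ

0-χ≤0 : ∀ b → 0ℤ - χ b ≤ 0ℤ
0-χ≤0 true  = -≤+
0-χ≤0 false = ℤ.≤-refl

χ-difference≤1 : ∀ b b′ → χ b - χ b′ ≤ 1ℤ
χ-difference≤1 true  true  = +≤+ z≤n
χ-difference≤1 true  false = ℤ.≤-refl
χ-difference≤1 false true  = -≤+
χ-difference≤1 false false = +≤+ z≤n

i<j⇒0<j-i : ∀ {i j} → i < j → 0ℤ < j - i
i<j⇒0<j-i i<j = ℤ.≰⇒> (λ j-i≤0 → ℤ.<⇒≱ i<j (ℤ.i-j≤0⇒i≤j j-i≤0))

0<j-i⇒i<j : ∀ {i j} → 0ℤ < j - i → i < j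
0<j-i⇒i<j 0<j-i = ℤ.≰⇒> (λ j≤i → ℤ.<⇒≱ 0<j-i (ℤ.i≤j⇒i-j≤0 j≤i))

0<i*n⇒0<i : ∀ i n → 0ℤ < i * + n → 0ℤ < i
0<i*n⇒0<i i n = ℤ.*-cancelʳ-<-nonNeg (+ n)

0<i⇒0<i*n : ∀ {i n} → 1 ℕ.≤ n → 0ℤ < i → 0ℤ < i * + n
0<i⇒0<i*n {n = n} 1≤n = ℤ.*-monoʳ-<-pos (+ n) {{positive (+<+ 1≤n)}}

module Walks (G : Graph) where
  open Graph G

  infixr 5 _++_
  _++_ : ∀ {u v w} → Walk G u v → Walk G v w → Walk G u w
  []      ++ r = r
  (s ∷ p) ++ r = s ∷ (p ++ r)

  reverse-step : ∀ {u v} → Step G u v → Step G v u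
  reverse-step (fwd x) = bwd x
  reverse-step (bwd x) = fwd x

  reverse : ∀ {u v} → Walk G u v → Walk G v u
  reverse []      = []
  reverse (s ∷ p) = reverse p ++ (reverse-step s ∷ [])

  module _ {P : Fin nE → Set} where

    All-++ : ∀ {u v w} (p : Walk G u v) {r : Walk G v w} →
             All P (edges G p) → All P (edges G r) → All P (edges G (p ++ r))
    All-++ []      _         Pr = Pr
    All-++ (_ ∷ p) (Ps ∷ Pp) Pr = Ps ∷ All-++ p Pp Pr

    All-reverse : ∀ {u v} (p : Walk G u v) → All P (edges G p) → All P (edges G (reverse p))
    All-reverse []          _         = []
    All-reverse (fwd x ∷ p) (Px ∷ Pp) = All-++ (reverse p) (All-reverse p Pp) (Px ∷ [])
    All-reverse (bwd x ∷ p) (Px ∷ Pp) = All-++ (reverse p) (All-reverse p Pp) (Px ∷ [])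

    bypass : ∀ {u v u′ v′} (s : Step G u v) (d : Walk G u v) → All P (edges G d) →
             (s′ : Step G u′ v′) → stepEdge G s′ ≡ stepEdge G s → Σ (Walk G u′ v′) (All P ∘ edges G)
    bypass (fwd x) d Pd (fwd .x) refl = d , Pd
    bypass (fwd x) d Pd (bwd .x) refl = reverse d , All-reverse d Pd
    bypass (bwd x) d Pd (fwd .x) refl = reverse d , All-reverse d Pd
    bypass (bwd x) d Pd (bwd .x) refl = d , Pd

  connected-without : Connected G → ∀ {u v} (s : Step G u v) (d : Walk G u v) →
                      All (_≢ stepEdge G s) (edges G d) → ConnectedWithout G (stepEdge G s)
  connected-without conn s d d-avoids u v = reroute (conn u v)
    where
    reroute : ∀ {u v} → Walk G u v → Σ (Walk G u v) (All (_≢ stepEdge G s) ∘ edges G)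
    reroute []       = [] , []
    reroute (s′ ∷ w) with stepEdge G s′ ≟ stepEdge G s | reroute w
    ... | no differ | w′ , w′-avoids = s′ ∷ w′ , differ ∷ w′-avoids
    ... | yes same  | w′ , w′-avoids with bypass s d d-avoids s′ same
    ...   | b , b-avoids = b ++ w′ , All-++ b b-avoids w′-avoids

  head∈vertices : ∀ {u v} (w : Walk G u v) → u ∈ vertices G w
  head∈vertices []      = here refl
  head∈vertices (_ ∷ _) = here refl

  last∈vertices : ∀ {u v} (w : Walk G u v) → v ∈ vertices G w
  last∈vertices []      = here refl
  last∈vertices (_ ∷ w) = there (last∈vertices w)

  endpoints∈vertices : ∀ {u v} (w : Walk G u v) {y} → y ∈ edges G w →
                       src y ∈ vertices G w × tgt y ∈ vertices G w
  endpoints∈vertices (fwd x ∷ w) (here refl) = here refl , there (head∈vertices w)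
  endpoints∈vertices (bwd x ∷ w) (here refl) = there (head∈vertices w) , here refl
  endpoints∈vertices (_ ∷ w)     (there y∈w) with endpoints∈vertices w y∈w
  ... | src∈w , tgt∈w = there src∈w , there tgt∈w

  start-is-endpoint : ∀ {u v} (s : Step G u v) → u ≡ src (stepEdge G s) ⊎ u ≡ tgt (stepEdge G s)
  start-is-endpoint (fwd x) = inj₁ refl
  start-is-endpoint (bwd x) = inj₂ refl

  avoids-edges-at : ∀ {u v m n} (s : Step G u v) (w : Walk G m n) →
                    All (u ≢_) (vertices G w) → All (_≢ stepEdge G s) (edges G w)
  avoids-edges-at s w u∉w = All.tabulate avoid
    where
    avoid : ∀ {y} → y ∈ edges G w → y ≢ stepEdge G s
    avoid y∈w refl with endpoints∈vertices w y∈w | start-is-endpoint s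
    ... | src∈w , _ | inj₁ u≡src = All.lookup u∉w src∈w u≡src
    ... | _ , tgt∈w | inj₂ u≡tgt = All.lookup u∉w tgt∈w u≡tgt

  step-determined-by-edge : ∀ {u u′ v v′} (s : Step G u v) (s′ : Step G u′ v′) →
    u ≡ u′ → u ≢ v → stepEdge G s ≡ stepEdge G s′ →
    _≡_ {A = Σ[ u ∈ Fin nV ] Σ[ v ∈ Fin nV ] Step G u v} (u , v , s) (u′ , v′ , s′)
  step-determined-by-edge (fwd x) (fwd .x) _       _       refl = refl
  step-determined-by-edge (bwd x) (bwd .x) _       _       refl = refl
  step-determined-by-edge (fwd x) (bwd .x) src≡tgt src≢tgt refl = contradiction src≡tgt src≢tgt
  step-determined-by-edge (bwd x) (fwd .x) tgt≡src tgt≢src refl = contradiction tgt≡src tgt≢src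

  disconnecting-path-unique : Connected G → ∀ {u v} (w w′ : Walk G u v) → IsPath G w → IsPath G w′ →
                              All (Disconnecting G) (edges G w′) → w′ ≡ w
  disconnecting-path-unique conn [] [] _ _ _ = refl
  disconnecting-path-unique conn [] (_ ∷ t′) _ (u∉t′ ∷ _) _ =
    contradiction refl (All.lookup u∉t′ (last∈vertices t′))
  disconnecting-path-unique conn (_ ∷ t) [] (u∉t ∷ _) _ _ =
    contradiction refl (All.lookup u∉t (last∈vertices t))
  disconnecting-path-unique conn (s ∷ t) (s′ ∷ t′) (u∉t ∷ t-path) (u∉t′ ∷ t′-path) (s′-disc ∷ t′-disc)
    with stepEdge G s ≟ stepEdge G s′
  ... | no differ = contradiction (connected-without conn s′ ((s ∷ t) ++ reverse t′) detour-avoids) s′-disc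
    where
    detour-avoids : All (_≢ stepEdge G s′) (edges G ((s ∷ t) ++ reverse t′))
    detour-avoids = All-++ (s ∷ t) (differ ∷ avoids-edges-at s′ t u∉t)
                           (All-reverse t′ (avoids-edges-at s′ t′ u∉t′))
  ... | yes same with step-determined-by-edge s s′ refl (All.lookup u∉t (head∈vertices t)) same
  ...   | refl = cong (s ∷_) (disconnecting-path-unique conn t t′ t-path t′-path t′-disc)

module Potential (G : Graph) (a : Fin (Graph.nV G) → ℤ) where
  open Graph G
  open Walks G

  data Ascending : ∀ {u v} → Walk G u v → Set where
    []  : ∀ {u} → Ascending {u} []
    _∷_ : ∀ {u v w} {s : Step G u v} {p : Walk G v w} → a u < a v → Ascending p → Ascending (s ∷ p)

  ascending-++ : ∀ {u v w} {p : Walk G u v} {r : Walk G v w} →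
                 Ascending p → Ascending r → Ascending (p ++ r)
  ascending-++ []         r↑ = r↑
  ascending-++ (u<v ∷ p↑) r↑ = u<v ∷ ascending-++ p↑ r↑

  ascending-above-start : ∀ {u v} {w : Walk G u v} → Ascending w → All (λ y → a u ≤ a y) (vertices G w)
  ascending-above-start []         = ℤ.≤-refl ∷ []
  ascending-above-start (u<v ∷ w↑) =
    ℤ.≤-refl ∷ All.map (ℤ.≤-trans (ℤ.<⇒≤ u<v)) (ascending-above-start w↑)

  ascending⇒path : ∀ {u v} {w : Walk G u v} → Ascending w → IsPath G w
  ascending⇒path []         = [] ∷ []
  ascending⇒path (u<v ∷ w↑) =
    All.map (λ { v≤y refl → ℤ.<-irrefl refl (ℤ.<-≤-trans u<v v≤y) }) (ascending-above-start w↑)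
    ∷ ascending⇒path w↑

  ascending-walk : (C : Fin nV) (P : Fin nV → Set) →
    (∀ {v} → P v → Σ[ u ∈ Fin nV ] Σ[ s ∈ Step G u v ] (a u < a v × (u ≡ C ⊎ P u))) →
    ∀ {v} → P v → Σ (Walk G C v) Ascending
  ascending-walk C P descend {v} =
    go (spo-wellFounded (On.isStrictPartialOrder a ℤ.<-isStrictPartialOrder) v)
    where
    go : ∀ {v} → Acc (_<_ on a) v → P v → Σ (Walk G C v) Ascending
    go (acc below) Pv with descend Pv
    ... | u , s , u<v , inj₁ refl = s ∷ [] , u<v ∷ []
    ... | u , s , u<v , inj₂ Pu with go (below u<v) Pu
    ...   | w , w↑ = w ++ (s ∷ []) , ascending-++ w↑ (u<v ∷ [])

  record Crossing (t : ℤ) : Set where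
    constructor crossing
    field
      {from to} : Fin nV
      step      : Step G from to
      from≤t    : a from ≤ t
      t<to      : t < a to

    edge : Fin nE
    edge = stepEdge G step

  open Crossing public using (edge)

  crossing-on-walk : ∀ t {u v} (w : Walk G u v) → a u ≤ t → t < a v →
                     Σ[ c ∈ Crossing t ] edge c ∈ edges G w
  crossing-on-walk t []                u≤t t<u = contradiction (ℤ.≤-<-trans u≤t t<u) (ℤ.<-irrefl refl)
  crossing-on-walk t (_∷_ {v = m} s w) u≤t t<v with a m ≤? t
  ... | no  m≰t = crossing s u≤t (ℤ.≰⇒> m≰t) , here refl
  ... | yes m≤t with crossing-on-walk t w m≤t t<v
  ...   | c , c∈w = c , there c∈w

module Divergence (G : Graph) where
  open Graph G

  outflow : (Fin nE → ℤ) → Fin nV → Fin nE → ℤ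
  outflow q C x = single (src x) (q x) C - single (tgt x) (q x) C

  ∑-*-δ : ∀ (w : Fin nV → ℤ) q →
          ∑[ C < nV ] (w C * δ G q C) ≡ ∑[ x < nE ] ((w (src x) - w (tgt x)) * q x)
  ∑-*-δ w q = begin
    ∑[ C < nV ] (w C * δ G q C)
      ≡⟨ sum-cong-≗ (λ C → cong (w C *_) (sumℤ≡sum nE (outflow q C))) ⟩
    ∑[ C < nV ] (w C * ∑[ x < nE ] outflow q C x)
      ≡⟨ sum-cong-≗ (λ C → *-distribˡ-sum (w C) (outflow q C)) ⟩
    ∑[ C < nV ] ∑[ x < nE ] (w C * outflow q C x)
      ≡⟨ ∑-comm (λ C x → w C * outflow q C x) ⟩
    ∑[ x < nE ] ∑[ C < nV ] (w C * outflow q C x)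
      ≡⟨ sum-cong-≗ (λ x → ∑-*-single-difference w (src x) (tgt x) (q x)) ⟩
    ∑[ x < nE ] ((w (src x) - w (tgt x)) * q x)
      ∎
    where open ≡-Reasoning

module Flow (G : Graph) (a : Fin (Graph.nV G) → ℤ) (q : Fin (Graph.nE G) → ℤ)
            (thick≥1 : ∀ x → 1 ℕ.≤ Graph.thick G x) (a∈F : InF G a q) where
  open Graph G
  open Walks G
  open Potential G a
  open Divergence G

  flow : ∀ {u v} → Step G u v → ℤ
  flow (fwd x) = q x
  flow (bwd x) = - q x

  potential-difference : ∀ {u v} (s : Step G u v) → a v - a u ≡ flow s * + thick (stepEdge G s)
  potential-difference (fwd x) = a∈F x
  potential-difference (bwd x) = begin
    a (src x) - a (tgt x)      ≡⟨ ⁻¹-anti-homo‿- (a (tgt x)) (a (src x)) ⟨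
    - (a (tgt x) - a (src x))  ≡⟨ cong -_ (a∈F x) ⟩
    - (q x * + thick x)        ≡⟨ ℤ.neg-distribˡ-* (q x) (+ thick x) ⟩
    - q x * + thick x          ∎
    where open ≡-Reasoning

  ascent⇒positive-flow : ∀ {u v} (s : Step G u v) → a u < a v → 0ℤ < flow s
  ascent⇒positive-flow s u<v =
    0<i*n⇒0<i (flow s) _ (subst (0ℤ <_) (potential-difference s) (i<j⇒0<j-i u<v))

  positive-flow⇒ascent : ∀ {u v} (s : Step G u v) → 0ℤ < flow s → a u < a v
  positive-flow⇒ascent s 0<flow = 0<j-i⇒i<j
    (subst (0ℤ <_) (sym (potential-difference s)) (0<i⇒0<i*n (thick≥1 (stepEdge G s)) 0<flow))

  sublevel : ℤ → Fin nV → ℤ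
  sublevel t C = χ (isYes (a C ≤? t))

  cut-term : ℤ → Fin nE → ℤ
  cut-term t x = (sublevel t (src x) - sublevel t (tgt x)) * q x

  cut-term-step : ∀ t {u v} (s : Step G u v) →
                  cut-term t (stepEdge G s) ≡ (sublevel t u - sublevel t v) * flow s
  cut-term-step t (fwd x) = refl
  cut-term-step t (bwd x) = begin
    (S - T) * q x      ≡⟨ cong (_* q x) (⁻¹-anti-homo‿- T S) ⟨
    - (T - S) * q x    ≡⟨ ℤ.neg-distribˡ-* (T - S) (q x) ⟨
    - ((T - S) * q x)  ≡⟨ ℤ.neg-distribʳ-* (T - S) (q x) ⟩
    (T - S) * - q x    ∎
    where
    open ≡-Reasoning
    S = sublevel t (src x)
    T = sublevel t (tgt x)

  crossing-cut-term : ∀ {t} (c : Crossing t) → 1ℤ ≤ cut-term t (edge c)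
  crossing-cut-term {t} (crossing {u} {v} s u≤t t<v) = begin
    1ℤ                                      ≤⟨ ℤ.i<j⇒suc[i]≤j (ascent⇒positive-flow s (ℤ.≤-<-trans u≤t t<v)) ⟩
    flow s                                  ≡⟨ ℤ.*-identityˡ (flow s) ⟨
    (1ℤ - 0ℤ) * flow s                      ≡⟨ cong₂ (λ S T → (S - T) * flow s) u-below v-above ⟨
    (sublevel t u - sublevel t v) * flow s  ≡⟨ cut-term-step t s ⟨
    cut-term t (stepEdge G s)               ∎
    where
    open ℤ.≤-Reasoning
    u-below : sublevel t u ≡ 1ℤ
    u-below = if-yes (a u ≤? t) u≤t
    v-above : sublevel t v ≡ 0ℤ
    v-above = if-no (a v ≤? t) (ℤ.<⇒≱ t<v)

  cut-term-level : ∀ t x → sublevel t (src x) ≡ sublevel t (tgt x) → cut-term t x ≡ 0ℤ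
  cut-term-level t x same = begin
    (sublevel t (src x) - T) * q x  ≡⟨ cong (λ S → (S - T) * q x) same ⟩
    (T - T) * q x                   ≡⟨ cong (_* q x) (ℤ.+-inverseʳ T) ⟩
    0ℤ * q x                        ≡⟨ ℤ.*-zeroˡ (q x) ⟩
    0ℤ                              ∎
    where
    open ≡-Reasoning
    T = sublevel t (tgt x)

  cut-term-nonneg : ∀ t x → 0ℤ ≤ cut-term t x
  cut-term-nonneg t x = by-sides (a (src x) ≤? t) (a (tgt x) ≤? t)
    where
    level : ∀ {b} → sublevel t (src x) ≡ b → sublevel t (tgt x) ≡ b → 0ℤ ≤ cut-term t x
    level src≡b tgt≡b = ℤ.≤-reflexive (sym (cut-term-level t x (trans src≡b (sym tgt≡b))))

    by-sides : Dec (a (src x) ≤ t) → Dec (a (tgt x) ≤ t) → 0ℤ ≤ cut-term t x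
    by-sides (yes src≤t) (no  tgt≰t) =
      ℤ.≤-trans (+≤+ z≤n) (crossing-cut-term (crossing (fwd x) src≤t (ℤ.≰⇒> tgt≰t)))
    by-sides (no  src≰t) (yes tgt≤t) =
      ℤ.≤-trans (+≤+ z≤n) (crossing-cut-term (crossing (bwd x) tgt≤t (ℤ.≰⇒> src≰t)))
    by-sides (yes src≤t) (yes tgt≤t) =
      level (if-yes (a (src x) ≤? t) src≤t) (if-yes (a (tgt x) ≤? t) tgt≤t)
    by-sides (no  src≰t) (no  tgt≰t) =
      level (if-no (a (src x) ≤? t) src≰t) (if-no (a (tgt x) ≤? t) tgt≰t)

  outflow-at-src : ∀ x → src x ≢ tgt x → outflow q (src x) x ≡ q x
  outflow-at-src x src≢tgt = trans
    (cong₂ _-_ (if-yes (src x ≟ src x) refl) (if-no (tgt x ≟ src x) (src≢tgt ∘ sym)))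
    (ℤ.+-identityʳ (q x))

  outflow-at-tgt : ∀ x → src x ≢ tgt x → outflow q (tgt x) x ≡ - q x
  outflow-at-tgt x src≢tgt = trans
    (cong₂ _-_ (if-no (src x ≟ tgt x) src≢tgt) (if-yes (tgt x ≟ tgt x) refl))
    (ℤ.+-identityˡ (- q x))

  outflow-along : ∀ {u v} (s : Step G u v) → u ≢ v →
                  outflow q u (stepEdge G s) ≡ flow s × outflow q v (stepEdge G s) ≡ - flow s
  outflow-along (fwd x) src≢tgt = outflow-at-src x src≢tgt , outflow-at-tgt x src≢tgt
  outflow-along (bwd x) tgt≢src =
    outflow-at-tgt x (tgt≢src ∘ sym) ,
    trans (outflow-at-src x (tgt≢src ∘ sym)) (sym (ℤ.neg-involutive (q x)))

  nonzero-outflow⇒step : ∀ {v x} → outflow q v x ≢ 0ℤ →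
                         Σ[ u ∈ Fin nV ] Σ[ s ∈ Step G u v ] (stepEdge G s ≡ x × u ≢ v)
  nonzero-outflow⇒step {v} {x} out≢0 with src x ≟ v | tgt x ≟ v
  ... | yes refl | no  tgt≢src = tgt x , bwd x , refl , tgt≢src
  ... | no src≢v | yes refl    = src x , fwd x , refl , src≢v
  ... | yes refl | yes _       = contradiction (ℤ.+-inverseʳ (q x)) out≢0
  ... | no _     | no _        = contradiction refl out≢0

  inflow-step : ∀ {v x} → outflow q v x < 0ℤ →
                Σ[ u ∈ Fin nV ] Σ[ s ∈ Step G u v ] (a u < a v × 0ℤ < outflow q u x)
  inflow-step out<0 with nonzero-outflow⇒step (ℤ.<⇒≢ out<0)
  ... | u , s , refl , u≢v with outflow-along s u≢v
  ...   | out-u≡flow , out-v≡-flow =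
    u , s , positive-flow⇒ascent s 0<flow , subst (0ℤ <_) (sym out-u≡flow) 0<flow
    where
    0<flow : 0ℤ < flow s
    0<flow = ℤ.neg-cancel-< (subst (_< 0ℤ) out-v≡-flow out<0)

  module UnitFlow (C₁ C₂ : Fin nV) (δq≡ : ∀ C → δ G q C ≡ ind G C₁ C - ind G C₂ C) where

    cut-balance : ∀ t → ∑[ x < nE ] cut-term t x ≤ 1ℤ
    cut-balance t = begin
      ∑[ x < nE ] cut-term t x
        ≡⟨ ∑-*-δ (sublevel t) q ⟨
      ∑[ C < nV ] (sublevel t C * δ G q C)
        ≡⟨ sum-cong-≗ (cong (sublevel t _ *_) ∘ δq≡) ⟩
      ∑[ C < nV ] (sublevel t C * (single C₁ 1ℤ C - single C₂ 1ℤ C))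
        ≡⟨ ∑-*-single-difference (sublevel t) C₁ C₂ 1ℤ ⟩
      (sublevel t C₁ - sublevel t C₂) * 1ℤ
        ≡⟨ ℤ.*-identityʳ _ ⟩
      sublevel t C₁ - sublevel t C₂
        ≤⟨ χ-difference≤1 (isYes (a C₁ ≤? t)) (isYes (a C₂ ≤? t)) ⟩
      1ℤ
        ∎
      where open ℤ.≤-Reasoning

    crossing-edge-unique : ∀ {t} (c c′ : Crossing t) → edge c ≡ edge c′
    crossing-edge-unique {t} c c′ = decidable-stable (edge c ≟ edge c′) λ differ →
      ℤ.<⇒≱ (+<+ (s≤s (s≤s z≤n))) (begin
        1ℤ + 1ℤ                                     ≤⟨ ℤ.+-mono-≤ (crossing-cut-term c) (crossing-cut-term c′) ⟩
        cut-term t (edge c) + cut-term t (edge c′)  ≤⟨ ∑-≥-two-terms (cut-term t) (cut-term-nonneg t) differ ⟩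
        ∑[ x < nE ] cut-term t x                    ≤⟨ cut-balance t ⟩
        1ℤ                                          ∎)
      where open ℤ.≤-Reasoning

    ascent-disconnecting : ∀ {u v} (s : Step G u v) → a u < a v → Disconnecting G (stepEdge G s)
    ascent-disconnecting {u} {v} s u<v connected-without-s with connected-without-s u v
    ... | w , w-avoids with crossing-on-walk (a u) w ℤ.≤-refl u<v
    ...   | c , c∈w = All.lookup w-avoids c∈w (sym (crossing-edge-unique (crossing s ℤ.≤-refl u<v) c))

    ascending-edges-disconnecting : ∀ {u v} {w : Walk G u v} → Ascending w → All (Disconnecting G) (edges G w)
    ascending-edges-disconnecting []                   = []
    ascending-edges-disconnecting (_∷_ {s = s} u<v w↑) =
      ascent-disconnecting s u<v ∷ ascending-edges-disconnecting w↑

    inflow-continues : ∀ {u x} → u ≢ C₁ → 0ℤ < outflow q u x → ∃[ x′ ] outflow q u x′ < 0ℤ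
    inflow-continues {u} {x} u≢C₁ 0<out = negative-term (outflow q u) λ out≥0 → ℤ.<⇒≱ 0<out (begin
      outflow q u x                    ≤⟨ ∑-≥-term (outflow q u) out≥0 x ⟩
      ∑[ x < nE ] outflow q u x        ≡⟨ sumℤ≡sum nE (outflow q u) ⟨
      δ G q u                          ≡⟨ δq≡ u ⟩
      single C₁ 1ℤ u - single C₂ 1ℤ u  ≡⟨ cong (_- single C₂ 1ℤ u) (if-no (C₁ ≟ u) (u≢C₁ ∘ sym)) ⟩
      0ℤ - χ (isYes (C₂ ≟ u))          ≤⟨ 0-χ≤0 (isYes (C₂ ≟ u)) ⟩
      0ℤ                               ∎)
      where open ℤ.≤-Reasoning

    sink-inflow : C₁ ≢ C₂ → ∃[ x ] outflow q C₂ x < 0ℤ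
    sink-inflow C₁≢C₂ = negative-term (outflow q C₂) λ out≥0 → ℤ.<⇒≱ -<+ (begin
      0ℤ                                 ≤⟨ ∑-nonneg (outflow q C₂) out≥0 ⟩
      ∑[ x < nE ] outflow q C₂ x         ≡⟨ sumℤ≡sum nE (outflow q C₂) ⟨
      δ G q C₂                           ≡⟨ δq≡ C₂ ⟩
      single C₁ 1ℤ C₂ - single C₂ 1ℤ C₂  ≡⟨ cong₂ _-_ (if-no (C₁ ≟ C₂) C₁≢C₂) (if-yes (C₂ ≟ C₂) refl) ⟩
      -1ℤ                                ∎)
      where open ℤ.≤-Reasoning

    ascending-walk-to-sink : C₁ ≢ C₂ → Σ (Walk G C₁ C₂) Ascending
    ascending-walk-to-sink C₁≢C₂ =
      ascending-walk C₁ (λ v → ∃[ x ] outflow q v x < 0ℤ) descend (sink-inflow C₁≢C₂)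
      where
      descend : ∀ {v} → ∃[ x ] outflow q v x < 0ℤ →
                Σ[ u ∈ Fin nV ] Σ[ s ∈ Step G u v ] (a u < a v × (u ≡ C₁ ⊎ ∃[ x ] outflow q u x < 0ℤ))
      descend (x , out<0) with inflow-step out<0
      ... | u , s , u<v , 0<out with u ≟ C₁
      ...   | yes u≡C₁ = u , s , u<v , inj₁ u≡C₁
      ...   | no  u≢C₁ = u , s , u<v , inj₂ (inflow-continues u≢C₁ 0<out)

proposition9p2 : (G : Graph) → (∀ x → 1 ℕ.≤ Graph.thick G x) → Connected G →
    (C₁ C₂ : Fin (Graph.nV G)) → C₁ ≢ C₂ → ImageZeroInΦ G C₁ C₂ →
    Σ (Walk G C₁ C₂) (λ w → (IsPath G w × All (Disconnecting G) (edges G w)) ×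
      (∀ (w′ : Walk G C₁ C₂) → IsPath G w′ → All (Disconnecting G) (edges G w′) → w′ ≡ w))
proposition9p2 G thick≥1 conn C₁ C₂ C₁≢C₂ (a , q , a∈F , δq≡) =
  path , (ascending⇒path path↑ , ascending-edges-disconnecting path↑) ,
  λ w′ w′-path w′-disconnecting →
    disconnecting-path-unique conn path w′ (ascending⇒path path↑) w′-path w′-disconnecting
  where
  open Walks G
  open Potential G a
  open Flow G a q thick≥1 a∈F
  open UnitFlow C₁ C₂ δq≡

  ascent : Σ (Walk G C₁ C₂) Ascending
  ascent = ascending-walk-to-sink C₁≢C₂

  path : Walk G C₁ C₂
  path = proj₁ ascent

  path↑ : Ascending path
  path↑ = proj₂ ascent
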